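{- Let $m,n,r\ge0$ and $k\ge0$ be integers and $\alpha,\beta,x$ indeterminates. Then $$S(m+n,k;\alpha,\beta,r)=\sum_{i=0}^n \sum_{j=0}^m \binom{n}{i}S(m,j;\alpha,\beta,r)\,S(i,k-j;\alpha,\beta,r)\prod_{\ell=0}^{n-i-1}((m+\ell)\alpha+j\beta)$$ and $$B_{m+n;\alpha,\beta,r}(x)=\sum_{i=0}^n \sum_{j=0}^m \binom{n}{i}x^jS(m,j;\alpha,\beta,r)\,B_{i;\alpha,\beta,r}(x)\prod_{\ell=0}^{n-i-1}((m+\ell)\alpha+j\beta).$$
   Context: For $\theta$ and $k\ge1$ let $(x)^{(k,\theta)}=x(x-\theta)\cdots(x-k\theta+\theta)$, and $(x)^{(0,\theta)}=1$. The generalized Stirling numbers $S(n,k;\alpha,\beta,r)$ are the coefficients defined by the polynomial identity $(x)^{(n,-\alpha)}=\sum_{k=0}^n S(n,k;\alpha,\beta,r)(x-r)^{(k,\beta)}$, with $S(n,k;\alpha,\beta,r)=0$ for $k<0$ or $k>n$. The generalized Bell polynomial is $B_{n;\alpha,\beta,r}(x)=\sum_{k=0}^n S(n,k;\alpha,\beta,r)x^k$. Empty products equal $1$. -}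

module Defs where

open import Data.Nat using (ℕ; zero; suc)
open import Data.Integer using (ℤ; +_; _+_; _-_; _*_; -_; _^_; _<_; _>_)
open import Relation.Binary.PropositionalEquality using (_≡_)

sumTo : ℕ → (ℕ → ℤ) → ℤ
sumTo zero    f = f zero
sumTo (suc n) f = sumTo n f + f (suc n)

prodBelow : ℕ → (ℕ → ℤ) → ℤ
prodBelow zero    f = + 1
prodBelow (suc n) f = prodBelow n f * f n

-- generalized falling factorial (x)^{(k,θ)} = x (x-θ) ⋯ (x-kθ+θ)
gfall : ℤ → ℕ → ℤ → ℤ
gfall x k θ = prodBelow k (λ i → x - (+ i) * θ)

record IsGenStirling (α β : ℤ) (r : ℕ) (S : ℕ → ℤ → ℤ) : Set where
  field
    vanish-neg : ∀ n k → k < + 0 → S n k ≡ + 0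
    vanish-big : ∀ n k → k > + n → S n k ≡ + 0
    expansion  : ∀ n (x : ℤ) →
      gfall x n (- α) ≡ sumTo n (λ k → S n (+ k) * gfall (x - + r) k β)

bell : (ℕ → ℤ → ℤ) → ℕ → ℤ → ℤ
bell S n x = sumTo n (λ k → S n (+ k) * x ^ k)

-- Multiplying (x)^{(n,-α)} = Σ_k S(n,k) (x-r)^{(k,β)} by x + nα and comparing coefficients in
-- the basis (x-r)^{(k,β)} gives the triangular recurrence
--   S(n+1,K) = S(n,K-1) + (Kβ + nα + r) S(n,K),
-- which, with the row n = 0, determines S. As functions of (n,K), both sides of the addition
-- formula satisfy it with r replaced by r + mα: for the right-hand side, Pascal's rule shows that
-- the binomial transform Σ_i C(n,i) (a)^{(n-i,-α)} S(i,K) raises r by a, and for a = jβ + mα the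
-- shift K ↦ K - j takes back jβ. At n = 0 both sides equal S(m,K). The Bell polynomial identity
-- follows by summing against x^K.

module Submission where

open import Defs
open import Data.Nat using (ℕ; zero; suc; _∸_; z≤n; s≤s)
import Data.Nat as ℕ
import Data.Nat.Properties as ℕP
open import Data.Nat.Combinatorics using (_C_; nCk+nC[k+1]≡[n+1]C[k+1]; k>n⇒nCk≡0)
open import Data.Integer
  using (ℤ; +_; -[1+_]; _+_; _-_; _*_; -_; _^_; _<_; _>_; _≤_; ∣_∣; 0ℤ; 1ℤ; -1ℤ; +≤+; -≤+; +<+; -<+)
import Data.Integer.Properties as ℤP
open import Data.Integer.Tactic.RingSolver using (solve-∀)
open import Data.Product using (_×_; _,_)
open import Data.Sum using ([_,_]′)
open import Data.Empty using (⊥; ⊥-elim)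
open import Function using (_∘_; id)
open import Relation.Nullary using (yes; no)
open import Relation.Binary.PropositionalEquality
open ≡-Reasoning

-- Finite sums

sumTo-cong : ∀ n {f g : ℕ → ℤ} → (∀ i → i ℕ.≤ n → f i ≡ g i) → sumTo n f ≡ sumTo n g
sumTo-cong zero    f≡g = f≡g 0 z≤n
sumTo-cong (suc n) f≡g =
  cong₂ _+_ (sumTo-cong n (λ i i≤n → f≡g i (ℕP.m≤n⇒m≤1+n i≤n))) (f≡g (suc n) ℕP.≤-refl)

sumTo-zero : ∀ n {f : ℕ → ℤ} → (∀ i → i ℕ.≤ n → f i ≡ 0ℤ) → sumTo n f ≡ 0ℤ
sumTo-zero zero    f≡0 = f≡0 0 z≤n
sumTo-zero (suc n) f≡0 =
  cong₂ _+_ (sumTo-zero n (λ i i≤n → f≡0 i (ℕP.m≤n⇒m≤1+n i≤n))) (f≡0 (suc n) ℕP.≤-refl)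

sumTo-+ : ∀ n (f g : ℕ → ℤ) → sumTo n (λ i → f i + g i) ≡ sumTo n f + sumTo n g
sumTo-+ zero    f g = refl
sumTo-+ (suc n) f g = begin
  sumTo n (λ i → f i + g i) + (f (suc n) + g (suc n))
    ≡⟨ cong (_+ (f (suc n) + g (suc n))) (sumTo-+ n f g) ⟩
  (sumTo n f + sumTo n g) + (f (suc n) + g (suc n))
    ≡⟨ interchange (sumTo n f) (sumTo n g) (f (suc n)) (g (suc n)) ⟩
  (sumTo n f + f (suc n)) + (sumTo n g + g (suc n)) ∎
  where
  interchange : ∀ a b c d → (a + b) + (c + d) ≡ (a + c) + (b + d)
  interchange = solve-∀

sumTo-- : ∀ n (f g : ℕ → ℤ) → sumTo n (λ i → f i - g i) ≡ sumTo n f - sumTo n g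
sumTo-- zero    f g = refl
sumTo-- (suc n) f g = begin
  sumTo n (λ i → f i - g i) + (f (suc n) - g (suc n))
    ≡⟨ cong (_+ (f (suc n) - g (suc n))) (sumTo-- n f g) ⟩
  (sumTo n f - sumTo n g) + (f (suc n) - g (suc n))
    ≡⟨ interchange (sumTo n f) (sumTo n g) (f (suc n)) (g (suc n)) ⟩
  (sumTo n f + f (suc n)) - (sumTo n g + g (suc n)) ∎
  where
  interchange : ∀ a b c d → (a - b) + (c - d) ≡ (a + c) - (b + d)
  interchange = solve-∀

sumTo-*ˡ : ∀ n a (f : ℕ → ℤ) → sumTo n (λ i → a * f i) ≡ a * sumTo n f
sumTo-*ˡ zero    a f = refl
sumTo-*ˡ (suc n) a f = trans (cong (_+ a * f (suc n)) (sumTo-*ˡ n a f))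
                             (sym (ℤP.*-distribˡ-+ a (sumTo n f) (f (suc n))))

sumTo-*ʳ : ∀ n a (f : ℕ → ℤ) → sumTo n (λ i → f i * a) ≡ sumTo n f * a
sumTo-*ʳ n a f = begin
  sumTo n (λ i → f i * a) ≡⟨ sumTo-cong n (λ i _ → ℤP.*-comm (f i) a) ⟩
  sumTo n (λ i → a * f i) ≡⟨ sumTo-*ˡ n a f ⟩
  a * sumTo n f           ≡⟨ ℤP.*-comm a _ ⟩
  sumTo n f * a           ∎

sumTo-suc : ∀ n (f : ℕ → ℤ) → sumTo (suc n) f ≡ f 0 + sumTo n (λ i → f (suc i))
sumTo-suc zero    f = refl
sumTo-suc (suc n) f = begin
  sumTo (suc n) f + f (suc (suc n))
    ≡⟨ cong (_+ f (suc (suc n))) (sumTo-suc n f) ⟩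
  (f 0 + sumTo n (λ i → f (suc i))) + f (suc (suc n))
    ≡⟨ ℤP.+-assoc (f 0) _ _ ⟩
  f 0 + (sumTo n (λ i → f (suc i)) + f (suc (suc n))) ∎

sumTo-swap : ∀ n m (f : ℕ → ℕ → ℤ) →
  sumTo n (λ i → sumTo m (λ j → f i j)) ≡ sumTo m (λ j → sumTo n (λ i → f i j))
sumTo-swap zero    m f = refl
sumTo-swap (suc n) m f = begin
  sumTo n (λ i → sumTo m (λ j → f i j)) + sumTo m (λ j → f (suc n) j)
    ≡⟨ cong (_+ sumTo m (λ j → f (suc n) j)) (sumTo-swap n m f) ⟩
  sumTo m (λ j → sumTo n (λ i → f i j)) + sumTo m (λ j → f (suc n) j)
    ≡⟨ sumTo-+ m _ _ ⟨
  sumTo m (λ j → sumTo n (λ i → f i j) + f (suc n) j) ∎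

sumTo-single : ∀ n k (f : ℕ → ℤ) → k ℕ.≤ n → (∀ i → i ℕ.≤ n → i ≢ k → f i ≡ 0ℤ) →
  sumTo n f ≡ f k
sumTo-single zero .zero f z≤n _ = refl
sumTo-single (suc n) k f k≤1+n others with k ℕ.≟ suc n
... | yes refl = begin
  sumTo n f + f (suc n)
    ≡⟨ cong (_+ f (suc n)) (sumTo-zero n (λ i i≤n → others i (ℕP.m≤n⇒m≤1+n i≤n)
                                            (ℕP.<⇒≢ (s≤s i≤n)))) ⟩
  0ℤ + f (suc n) ≡⟨ ℤP.+-identityˡ _ ⟩
  f (suc n)      ∎
... | no k≢1+n = begin
  sumTo n f + f (suc n)
    ≡⟨ cong₂ _+_ (sumTo-single n k f (ℕP.≤-pred (ℕP.≤∧≢⇒< k≤1+n k≢1+n))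
                   (λ i i≤n → others i (ℕP.m≤n⇒m≤1+n i≤n)))
                 (others (suc n) ℕP.≤-refl (k≢1+n ∘ sym)) ⟩
  f k + 0ℤ ≡⟨ ℤP.+-identityʳ _ ⟩
  f k      ∎

sumTo-extend : ∀ {m n} (f : ℕ → ℤ) → m ℕ.≤ n → (∀ i → m ℕ.< i → f i ≡ 0ℤ) →
  sumTo n f ≡ sumTo m f
sumTo-extend {m} f m≤n f≡0 = trans (cong (λ t → sumTo t f) (sym (ℕP.m+[n∸m]≡n m≤n))) (go (_ ∸ m))
  where
  go : ∀ d → sumTo (m ℕ.+ d) f ≡ sumTo m f
  go zero    = cong (λ t → sumTo t f) (ℕP.+-identityʳ m)
  go (suc d) = begin
    sumTo (m ℕ.+ suc d) f         ≡⟨ cong (λ t → sumTo t f) (ℕP.+-suc m d) ⟩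
    sumTo (m ℕ.+ d) f + f (suc (m ℕ.+ d))
      ≡⟨ cong₂ _+_ (go d) (f≡0 _ (s≤s (ℕP.m≤m+n m d))) ⟩
    sumTo m f + 0ℤ                ≡⟨ ℤP.+-identityʳ _ ⟩
    sumTo m f                     ∎

sumTo-dropInit : ∀ j n (f : ℕ → ℤ) → (∀ i → i ℕ.< j → f i ≡ 0ℤ) →
  sumTo (j ℕ.+ n) f ≡ sumTo n (λ i → f (j ℕ.+ i))
sumTo-dropInit zero    n f _   = refl
sumTo-dropInit (suc j) n f f≡0 = begin
  sumTo (suc (j ℕ.+ n)) f                  ≡⟨ sumTo-suc (j ℕ.+ n) f ⟩
  f 0 + sumTo (j ℕ.+ n) (λ i → f (suc i))
    ≡⟨ cong₂ _+_ (f≡0 0 (s≤s z≤n))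
                 (sumTo-dropInit j n (f ∘ suc) (λ i i<j → f≡0 (suc i) (s≤s i<j))) ⟩
  0ℤ + sumTo n (λ i → f (suc (j ℕ.+ i)))   ≡⟨ ℤP.+-identityˡ _ ⟩
  sumTo n (λ i → f (suc j ℕ.+ i))          ∎

sumTo-pascal : ∀ n (g : ℕ → ℤ) →
  sumTo (suc n) (λ i → + (suc n C i) * g i) ≡ sumTo n (λ i → + (n C i) * (g i + g (suc i)))
sumTo-pascal n g = begin
  sumTo (suc n) (λ i → + (suc n C i) * g i)
    ≡⟨ sumTo-suc n _ ⟩
  1ℤ * g 0 + sumTo n (λ i → + (suc n C suc i) * g (suc i))
    ≡⟨ cong (λ t → 1ℤ * g 0 + t) (sumTo-cong n (λ i _ → pascal i)) ⟩
  1ℤ * g 0 + sumTo n (λ i → + (n C suc i) * g (suc i) + + (n C i) * g (suc i))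
    ≡⟨ cong (λ t → 1ℤ * g 0 + t) (sumTo-+ n _ _) ⟩
  1ℤ * g 0 + (sumTo n (λ i → + (n C suc i) * g (suc i)) + sumTo n (λ i → + (n C i) * g (suc i)))
    ≡⟨ ℤP.+-assoc (1ℤ * g 0) _ _ ⟨
  (1ℤ * g 0 + sumTo n (λ i → + (n C suc i) * g (suc i))) + sumTo n (λ i → + (n C i) * g (suc i))
    ≡⟨ cong (_+ sumTo n (λ i → + (n C i) * g (suc i))) lowerRow ⟩
  sumTo n (λ i → + (n C i) * g i) + sumTo n (λ i → + (n C i) * g (suc i))
    ≡⟨ sumTo-+ n _ _ ⟨
  sumTo n (λ i → + (n C i) * g i + + (n C i) * g (suc i))
    ≡⟨ sumTo-cong n (λ i _ → ℤP.*-distribˡ-+ (+ (n C i)) (g i) (g (suc i))) ⟨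
  sumTo n (λ i → + (n C i) * (g i + g (suc i))) ∎
  where
  pascal : ∀ i → + (suc n C suc i) * g (suc i) ≡ + (n C suc i) * g (suc i) + + (n C i) * g (suc i)
  pascal i = begin
    + (suc n C suc i) * g (suc i)
      ≡⟨ cong (λ c → + c * g (suc i)) (nCk+nC[k+1]≡[n+1]C[k+1] n i) ⟨
    + (n C i ℕ.+ n C suc i) * g (suc i)
      ≡⟨ cong (_* g (suc i)) (trans (ℤP.pos-+ (n C i) (n C suc i)) (ℤP.+-comm (+ (n C i)) (+ (n C suc i)))) ⟩
    (+ (n C suc i) + + (n C i)) * g (suc i)
      ≡⟨ ℤP.*-distribʳ-+ (g (suc i)) (+ (n C suc i)) (+ (n C i)) ⟩
    + (n C suc i) * g (suc i) + + (n C i) * g (suc i) ∎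
  lowerRow : 1ℤ * g 0 + sumTo n (λ i → + (n C suc i) * g (suc i)) ≡ sumTo n (λ i → + (n C i) * g i)
  lowerRow = begin
    1ℤ * g 0 + sumTo n (λ i → + (n C suc i) * g (suc i))
      ≡⟨ sumTo-suc n (λ i → + (n C i) * g i) ⟨
    sumTo n (λ i → + (n C i) * g i) + + (n C suc n) * g (suc n)
      ≡⟨ cong (λ c → sumTo n (λ i → + (n C i) * g i) + + c * g (suc n)) (k>n⇒nCk≡0 (ℕP.n<1+n n)) ⟩
    sumTo n (λ i → + (n C i) * g i) + 0ℤ * g (suc n)
      ≡⟨ ℤP.+-identityʳ _ ⟩
    sumTo n (λ i → + (n C i) * g i) ∎

prodBelow-cong : ∀ n {f g : ℕ → ℤ} → (∀ i → f i ≡ g i) → prodBelow n f ≡ prodBelow n g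
prodBelow-cong zero    f≡g = refl
prodBelow-cong (suc n) f≡g = cong₂ _*_ (prodBelow-cong n f≡g) (f≡g n)

+m-+n<0 : ∀ {m n} → m ℕ.< n → + m - + n < 0ℤ
+m-+n<0 {m} {n} m<n = subst (_< 0ℤ) (sym (trans (ℤP.m-n≡m⊖n m n) (ℤP.⊖-< m<n)))
                             (ℤP.neg-mono-< (+<+ (ℕP.m<n⇒0<n∸m m<n)))

sumTo-shiftedCoeffs : ∀ (c : ℤ → ℤ) i j N x →
  (∀ K → K < 0ℤ → c K ≡ 0ℤ) → (∀ K → K > + i → c K ≡ 0ℤ) → j ℕ.+ i ℕ.≤ N →
  sumTo N (λ K → c (+ K - + j) * x ^ K) ≡ x ^ j * sumTo i (λ k → c (+ k) * x ^ k)
sumTo-shiftedCoeffs c i j N x c<0≡0 c>i≡0 j+i≤N = begin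
  sumTo N (λ K → c (+ K - + j) * x ^ K)
    ≡⟨ cong (λ l → sumTo l (λ K → c (+ K - + j) * x ^ K))
            (ℕP.m+[n∸m]≡n (ℕP.m+n≤o⇒m≤o j j+i≤N)) ⟨
  sumTo (j ℕ.+ (N ∸ j)) (λ K → c (+ K - + j) * x ^ K)
    ≡⟨ sumTo-dropInit j (N ∸ j) _ (λ K K<j →
         trans (cong (_* x ^ K) (c<0≡0 _ (+m-+n<0 K<j))) (ℤP.*-zeroˡ (x ^ K))) ⟩
  sumTo (N ∸ j) (λ k → c (+ (j ℕ.+ k) - + j) * x ^ (j ℕ.+ k))
    ≡⟨ sumTo-cong (N ∸ j) (λ k _ → shift k) ⟩
  sumTo (N ∸ j) (λ k → x ^ j * (c (+ k) * x ^ k))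
    ≡⟨ sumTo-*ˡ (N ∸ j) (x ^ j) _ ⟩
  x ^ j * sumTo (N ∸ j) (λ k → c (+ k) * x ^ k)
    ≡⟨ cong (x ^ j *_) (sumTo-extend _ i≤N∸j (λ k i<k →
         trans (cong (_* x ^ k) (c>i≡0 _ (+<+ i<k))) (ℤP.*-zeroˡ (x ^ k)))) ⟩
  x ^ j * sumTo i (λ k → c (+ k) * x ^ k) ∎
  where
  i≤N∸j : i ℕ.≤ N ∸ j
  i≤N∸j = subst (ℕ._≤ N ∸ j) (ℕP.m+n∸m≡n j i) (ℕP.∸-monoˡ-≤ j j+i≤N)
  cancel : ∀ a b → a + b - a ≡ b
  cancel = solve-∀
  commute : ∀ c a b → c * (a * b) ≡ a * (c * b)
  commute = solve-∀
  shift : ∀ k → c (+ (j ℕ.+ k) - + j) * x ^ (j ℕ.+ k) ≡ x ^ j * (c (+ k) * x ^ k)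
  shift k = begin
    c (+ (j ℕ.+ k) - + j) * x ^ (j ℕ.+ k)
      ≡⟨ cong₂ (λ a b → c a * b) (trans (cong (_- + j) (ℤP.pos-+ j k)) (cancel (+ j) (+ k)))
                                 (ℤP.^-distribˡ-+-* x j k) ⟩
    c (+ k) * (x ^ j * x ^ k) ≡⟨ commute (c (+ k)) (x ^ j) (x ^ k) ⟩
    x ^ j * (c (+ k) * x ^ k) ∎

-- The basis (y)^{(k,β)}

gfall-suc : ∀ y k β → gfall y (suc k) β ≡ y * gfall (y - β) k β
gfall-suc y zero    β = shift y β
  where
  shift : ∀ y β → 1ℤ * (y - 0ℤ * β) ≡ y * 1ℤ
  shift = solve-∀
gfall-suc y (suc k) β = begin
  gfall y (suc k) β * (y - + suc k * β)
    ≡⟨ cong₂ _*_ (gfall-suc y k β) (cong (λ t → y - t * β) (ℤP.pos-+ 1 k)) ⟩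
  y * gfall (y - β) k β * (y - (1ℤ + + k) * β)
    ≡⟨ shift y (gfall (y - β) k β) (+ k) β ⟩
  y * (gfall (y - β) k β * ((y - β) - + k * β)) ∎
  where
  shift : ∀ y g k β → y * g * (y - (1ℤ + k) * β) ≡ y * (g * ((y - β) - k * β))
  shift = solve-∀

sumTo-gfall-suc : ∀ n (c : ℕ → ℤ) y β →
  sumTo (suc n) (λ k → c k * gfall y k β) ≡ c 0 + y * sumTo n (λ k → c (suc k) * gfall (y - β) k β)
sumTo-gfall-suc n c y β = begin
  sumTo (suc n) (λ k → c k * gfall y k β)
    ≡⟨ sumTo-suc n _ ⟩
  c 0 * 1ℤ + sumTo n (λ k → c (suc k) * gfall y (suc k) β)
    ≡⟨ cong₂ _+_ (ℤP.*-identityʳ (c 0))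
                 (sumTo-cong n (λ k _ → trans (cong (c (suc k) *_) (gfall-suc y k β))
                                              (commute (c (suc k)) y _))) ⟩
  c 0 + sumTo n (λ k → y * (c (suc k) * gfall (y - β) k β))
    ≡⟨ cong (λ t → c 0 + t) (sumTo-*ˡ n y _) ⟩
  c 0 + y * sumTo n (λ k → c (suc k) * gfall (y - β) k β) ∎
  where
  commute : ∀ a y g → a * (y * g) ≡ y * (a * g)
  commute = solve-∀

∣i∣<n∧i+n*j≡0⇒i≡0 : ∀ (i j : ℤ) (n : ℕ) → ∣ i ∣ ℕ.< n → i + + n * j ≡ 0ℤ → i ≡ 0ℤ
∣i∣<n∧i+n*j≡0⇒i≡0 i j n ∣i∣<n i+nj≡0 = ℤP.∣i∣≡0⇒i≡0 (∣i∣≡0 ∣ j ∣ ∣i∣≡n*∣j∣)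
  where
  i≡-nj : i ≡ - (+ n * j)
  i≡-nj = begin
    i                       ≡⟨ cancel i (+ n * j) ⟩
    (i + + n * j) - + n * j ≡⟨ cong (_- + n * j) i+nj≡0 ⟩
    0ℤ - + n * j            ≡⟨ ℤP.+-identityˡ _ ⟩
    - (+ n * j)             ∎
    where
    cancel : ∀ a b → a ≡ (a + b) - b
    cancel = solve-∀
  ∣i∣≡n*∣j∣ : ∣ i ∣ ≡ n ℕ.* ∣ j ∣
  ∣i∣≡n*∣j∣ = trans (cong ∣_∣ i≡-nj) (trans (ℤP.∣-i∣≡∣i∣ (+ n * j)) (ℤP.abs-* (+ n) j))
  ∣i∣≡0 : ∀ s → ∣ i ∣ ≡ n ℕ.* s → ∣ i ∣ ≡ 0
  ∣i∣≡0 zero    e = trans e (ℕP.*-zeroʳ n)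
  ∣i∣≡0 (suc s) e = ⊥-elim (ℕP.<⇒≱ ∣i∣<n (subst (n ℕ.≤_) (sym e) (ℕP.m≤m*n n (suc s))))

i≤+∣i∣ : ∀ i → i ≤ + ∣ i ∣
i≤+∣i∣ (+ n)    = ℤP.≤-refl
i≤+∣i∣ -[1+ n ] = -≤+

-- Evaluating at a large y forces c 0 = 0; what is left is y times a combination in y - β,
-- which must then vanish for all large y - β.
gfall-combination≡0⇒coeffs≡0 : ∀ β n (c : ℕ → ℤ) (M : ℤ) →
  (∀ y → M ≤ y → sumTo n (λ k → c k * gfall y k β) ≡ 0ℤ) → ∀ k → k ℕ.≤ n → c k ≡ 0ℤ
gfall-combination≡0⇒coeffs≡0 β zero c M vanish .zero z≤n =
  trans (sym (ℤP.*-identityʳ (c 0))) (vanish M ℤP.≤-refl)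
gfall-combination≡0⇒coeffs≡0 β (suc n) c M vanish = coeffs≡0
  where
  Y : ℕ
  Y = ∣ M ∣ ℕ.+ suc ∣ c 0 ∣

  c0≡0 : c 0 ≡ 0ℤ
  c0≡0 = ∣i∣<n∧i+n*j≡0⇒i≡0 (c 0) _ Y
    (ℕP.<-≤-trans (ℕP.n<1+n ∣ c 0 ∣) (ℕP.m≤n+m (suc ∣ c 0 ∣) ∣ M ∣))
    (trans (sym (sumTo-gfall-suc n c (+ Y) β))
           (vanish (+ Y) (ℤP.≤-trans (i≤+∣i∣ M) (+≤+ (ℕP.m≤m+n ∣ M ∣ _)))))

  M′ : ℤ
  M′ = + suc ∣ M ∣ - β

  tail≡0 : ∀ z → M′ ≤ z → sumTo n (λ k → c (suc k) * gfall z k β) ≡ 0ℤ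
  tail≡0 z M′≤z =
    [ (λ z+β≡0 → ⊥-elim (1+∣M∣≰0 (subst (+ suc ∣ M ∣ ≤_) z+β≡0 1+∣M∣≤z+β))) , id ]′
      (ℤP.i*j≡0⇒i≡0∨j≡0 (z + β) y*tail≡0)
    where
    1+∣M∣≰0 : + suc ∣ M ∣ ≤ 0ℤ → ⊥
    1+∣M∣≰0 (+≤+ ())
    1+∣M∣≤z+β : + suc ∣ M ∣ ≤ z + β
    1+∣M∣≤z+β = subst (_≤ z + β) (cancel (+ suc ∣ M ∣) β) (ℤP.+-monoˡ-≤ β M′≤z)
      where
      cancel : ∀ a b → a - b + b ≡ a
      cancel = solve-∀
    y*tail≡0 : (z + β) * sumTo n (λ k → c (suc k) * gfall z k β) ≡ 0ℤ
    y*tail≡0 = begin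
      (z + β) * sumTo n (λ k → c (suc k) * gfall z k β)
        ≡⟨ cong (λ w → (z + β) * sumTo n (λ k → c (suc k) * gfall w k β)) (cancel z β) ⟩
      (z + β) * sumTo n (λ k → c (suc k) * gfall (z + β - β) k β)
        ≡⟨ ℤP.+-identityˡ _ ⟨
      0ℤ + (z + β) * sumTo n (λ k → c (suc k) * gfall (z + β - β) k β)
        ≡⟨ cong (_+ (z + β) * sumTo n (λ k → c (suc k) * gfall (z + β - β) k β)) c0≡0 ⟨
      c 0 + (z + β) * sumTo n (λ k → c (suc k) * gfall (z + β - β) k β)
        ≡⟨ sumTo-gfall-suc n c (z + β) β ⟨
      sumTo (suc n) (λ k → c k * gfall (z + β) k β)
        ≡⟨ vanish (z + β)
             (ℤP.≤-trans (i≤+∣i∣ M) (ℤP.≤-trans (+≤+ (ℕP.n≤1+n _)) 1+∣M∣≤z+β)) ⟩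
      0ℤ ∎
      where
      cancel : ∀ a b → a ≡ a + b - b
      cancel = solve-∀

  coeffs≡0 : ∀ k → k ℕ.≤ suc n → c k ≡ 0ℤ
  coeffs≡0 zero    _         = c0≡0
  coeffs≡0 (suc k) (s≤s k≤n) = gfall-combination≡0⇒coeffs≡0 β n (c ∘ suc) M′ tail≡0 k k≤n

gfall-coeffs-unique : ∀ β n (a b : ℕ → ℤ) →
  (∀ y → sumTo n (λ k → a k * gfall y k β) ≡ sumTo n (λ k → b k * gfall y k β)) →
  ∀ k → k ℕ.≤ n → a k ≡ b k
gfall-coeffs-unique β n a b same k k≤n =
  ℤP.i-j≡0⇒i≡j _ _ (gfall-combination≡0⇒coeffs≡0 β n (λ k → a k - b k) 0ℤ difference≡0 k k≤n)
  where
  difference≡0 : ∀ y → 0ℤ ≤ y → sumTo n (λ k → (a k - b k) * gfall y k β) ≡ 0ℤ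
  difference≡0 y _ = begin
    sumTo n (λ k → (a k - b k) * gfall y k β)
      ≡⟨ sumTo-cong n (λ k _ → distrib (a k) (b k) (gfall y k β)) ⟩
    sumTo n (λ k → a k * gfall y k β - b k * gfall y k β)
      ≡⟨ sumTo-- n _ _ ⟩
    sumTo n (λ k → a k * gfall y k β) - sumTo n (λ k → b k * gfall y k β)
      ≡⟨ ℤP.i≡j⇒i-j≡0 (same y) ⟩
    0ℤ ∎
    where
    distrib : ∀ a b g → (a - b) * g ≡ a * g - b * g
    distrib = solve-∀

sumTo-gfall-* : ∀ n β (c : ℤ → ℤ) y t → c -1ℤ ≡ 0ℤ → c (+ suc n) ≡ 0ℤ →
  sumTo n (λ k → c (+ k) * gfall y k β) * (y + t)
    ≡ sumTo (suc n) (λ k → (c (+ k - 1ℤ) + (+ k * β + t) * c (+ k)) * gfall y k β)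
sumTo-gfall-* n β c y t c[-1]≡0 c[1+n]≡0 = begin
  sumTo n (λ k → c (+ k) * gfall y k β) * (y + t)
    ≡⟨ sumTo-*ʳ n (y + t) _ ⟨
  sumTo n (λ k → c (+ k) * gfall y k β * (y + t))
    ≡⟨ sumTo-cong n (λ k _ → split (c (+ k)) (gfall y k β) y t (+ k) β) ⟩
  sumTo n (λ k → c (+ k) * gfall y (suc k) β + lower k)
    ≡⟨ sumTo-+ n _ _ ⟩
  sumTo n (λ k → c (+ k) * gfall y (suc k) β) + sumTo n lower
    ≡⟨ cong₂ _+_ raised extended ⟩
  sumTo (suc n) raise + sumTo (suc n) lower
    ≡⟨ sumTo-+ (suc n) raise lower ⟨
  sumTo (suc n) (λ k → raise k + lower k)
    ≡⟨ sumTo-cong (suc n) (λ k _ → collect (c (+ k - 1ℤ)) (+ k * β + t) (c (+ k)) (gfall y k β)) ⟩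
  sumTo (suc n) (λ k → (c (+ k - 1ℤ) + (+ k * β + t) * c (+ k)) * gfall y k β) ∎
  where
  raise lower : ℕ → ℤ
  raise k = c (+ k - 1ℤ) * gfall y k β
  lower k = (+ k * β + t) * c (+ k) * gfall y k β
  split : ∀ c g y t k β → c * g * (y + t) ≡ c * (g * (y - k * β)) + (k * β + t) * c * g
  split = solve-∀
  collect : ∀ a b c g → a * g + b * c * g ≡ (a + b * c) * g
  collect = solve-∀
  raised : sumTo n (λ k → c (+ k) * gfall y (suc k) β) ≡ sumTo (suc n) raise
  raised = sym (begin
    sumTo (suc n) raise                                       ≡⟨ sumTo-suc n raise ⟩
    c -1ℤ * 1ℤ + sumTo n (λ k → c (+ k) * gfall y (suc k) β)
      ≡⟨ cong (λ a → a * 1ℤ + sumTo n (λ k → c (+ k) * gfall y (suc k) β)) c[-1]≡0 ⟩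
    0ℤ + sumTo n (λ k → c (+ k) * gfall y (suc k) β)          ≡⟨ ℤP.+-identityˡ _ ⟩
    sumTo n (λ k → c (+ k) * gfall y (suc k) β)               ∎)
  extended : sumTo n lower ≡ sumTo (suc n) lower
  extended = sym (begin
    sumTo n lower + (+ suc n * β + t) * c (+ suc n) * gfall y (suc n) β
      ≡⟨ cong (λ a → sumTo n lower + (+ suc n * β + t) * a * gfall y (suc n) β) c[1+n]≡0 ⟩
    sumTo n lower + (+ suc n * β + t) * 0ℤ * gfall y (suc n) β
      ≡⟨ annihilate (sumTo n lower) (+ suc n * β + t) (gfall y (suc n) β) ⟩
    sumTo n lower ∎)
    where
    annihilate : ∀ s a g → s + a * 0ℤ * g ≡ s
    annihilate = solve-∀

-- The triangular recurrence

module Recurrence (α β : ℤ) where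

  -- Satisfied by S(n,K;α,β,ρ), with K ranging over all of ℤ.
  StirlingRecurrence : ℤ → (ℕ → ℤ → ℤ) → Set
  StirlingRecurrence ρ U = ∀ n K → U (suc n) K ≡ U n (K - 1ℤ) + (K * β + (+ n * α + ρ)) * U n K

  StirlingRecurrence-unique : ∀ {ρ U V} → StirlingRecurrence ρ U → StirlingRecurrence ρ V →
    (∀ K → U 0 K ≡ V 0 K) → ∀ n K → U n K ≡ V n K
  StirlingRecurrence-unique {ρ} {U} {V} recU recV row0 = agree
    where
    agree : ∀ n K → U n K ≡ V n K
    agree zero    K = row0 K
    agree (suc n) K = begin
      U (suc n) K                                    ≡⟨ recU n K ⟩
      U n (K - 1ℤ) + (K * β + (+ n * α + ρ)) * U n K
        ≡⟨ cong₂ (λ a b → a + (K * β + (+ n * α + ρ)) * b) (agree n (K - 1ℤ)) (agree n K) ⟩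
      V n (K - 1ℤ) + (K * β + (+ n * α + ρ)) * V n K ≡⟨ recV n K ⟨
      V (suc n) K                                    ∎

  StirlingRecurrence-shiftRow : ∀ {ρ U} m → StirlingRecurrence ρ U →
    StirlingRecurrence (+ m * α + ρ) (λ n → U (m ℕ.+ n))
  StirlingRecurrence-shiftRow {ρ} {U} m rec n K = begin
    U (m ℕ.+ suc n) K
      ≡⟨ cong (λ l → U l K) (ℕP.+-suc m n) ⟩
    U (suc (m ℕ.+ n)) K
      ≡⟨ rec (m ℕ.+ n) K ⟩
    U (m ℕ.+ n) (K - 1ℤ) + (K * β + (+ (m ℕ.+ n) * α + ρ)) * U (m ℕ.+ n) K
      ≡⟨ cong (λ l → U (m ℕ.+ n) (K - 1ℤ) + (K * β + (l * α + ρ)) * U (m ℕ.+ n) K)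
              (trans (ℤP.pos-+ m n) (ℤP.+-comm (+ m) (+ n))) ⟩
    U (m ℕ.+ n) (K - 1ℤ) + (K * β + ((+ n + + m) * α + ρ)) * U (m ℕ.+ n) K
      ≡⟨ cong (λ c → U (m ℕ.+ n) (K - 1ℤ) + c * U (m ℕ.+ n) K) (regroup K β (+ n) (+ m) α ρ) ⟩
    U (m ℕ.+ n) (K - 1ℤ) + (K * β + (+ n * α + (+ m * α + ρ))) * U (m ℕ.+ n) K ∎
    where
    regroup : ∀ K β n m α ρ → K * β + ((n + m) * α + ρ) ≡ K * β + (n * α + (m * α + ρ))
    regroup = solve-∀

  StirlingRecurrence-shiftColumn : ∀ {ρ U} j → StirlingRecurrence (+ j * β + ρ) U →
    StirlingRecurrence ρ (λ n K → U n (K - + j))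
  StirlingRecurrence-shiftColumn {ρ} {U} j rec n K = begin
    U (suc n) (K - + j)
      ≡⟨ rec n (K - + j) ⟩
    U n (K - + j - 1ℤ) + ((K - + j) * β + (+ n * α + (+ j * β + ρ))) * U n (K - + j)
      ≡⟨ cong₂ (λ a c → U n a + c * U n (K - + j)) (swap K (+ j)) (regroup K (+ j) β (+ n) α ρ) ⟩
    U n (K - 1ℤ - + j) + (K * β + (+ n * α + ρ)) * U n (K - + j) ∎
    where
    swap : ∀ K j → K - j - 1ℤ ≡ K - 1ℤ - j
    swap = solve-∀
    regroup : ∀ K j β n α ρ → (K - j) * β + (n * α + (j * β + ρ)) ≡ K * β + (n * α + ρ)
    regroup = solve-∀

  StirlingRecurrence-sum : ∀ {ρ} m (c : ℕ → ℤ) (U : ℕ → ℕ → ℤ → ℤ) →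
    (∀ j → StirlingRecurrence ρ (U j)) →
    StirlingRecurrence ρ (λ n K → sumTo m (λ j → c j * U j n K))
  StirlingRecurrence-sum {ρ} m c U rec n K = begin
    sumTo m (λ j → c j * U j (suc n) K)
      ≡⟨ sumTo-cong m (λ j _ → trans (cong (c j *_) (rec j n K))
                                     (distrib (c j) (U j n (K - 1ℤ)) κ (U j n K))) ⟩
    sumTo m (λ j → c j * U j n (K - 1ℤ) + κ * (c j * U j n K))
      ≡⟨ sumTo-+ m _ _ ⟩
    sumTo m (λ j → c j * U j n (K - 1ℤ)) + sumTo m (λ j → κ * (c j * U j n K))
      ≡⟨ cong (λ s → sumTo m (λ j → c j * U j n (K - 1ℤ)) + s) (sumTo-*ˡ m κ _) ⟩
    sumTo m (λ j → c j * U j n (K - 1ℤ)) + κ * sumTo m (λ j → c j * U j n K) ∎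
    where
    κ : ℤ
    κ = K * β + (+ n * α + ρ)
    distrib : ∀ c a κ b → c * (a + κ * b) ≡ c * a + κ * (c * b)
    distrib = solve-∀

  binomialTransform : ℤ → (ℕ → ℤ → ℤ) → ℕ → ℤ → ℤ
  binomialTransform a U n K = sumTo n (λ i → + (n C i) * (gfall a (n ∸ i) (- α) * U i K))

  binomialTransform-zero : ∀ a U K → binomialTransform a U 0 K ≡ U 0 K
  binomialTransform-zero a U K = trans (ℤP.*-identityˡ (1ℤ * U 0 K)) (ℤP.*-identityˡ (U 0 K))

  -- Pascal's rule turns the transform at n+1 into one at n; the factor a + (n-i)α released by
  -- (a)^{(n+1-i,-α)} combines with the coefficient Kβ + iα + ρ of U into Kβ + nα + (a + ρ).
  StirlingRecurrence-binomialTransform : ∀ {ρ U} a → StirlingRecurrence ρ U →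
    StirlingRecurrence (a + ρ) (binomialTransform a U)
  StirlingRecurrence-binomialTransform {ρ} {U} a rec n K = begin
    sumTo (suc n) (λ i → + (suc n C i) * (g (suc n ∸ i) * U i K))
      ≡⟨ sumTo-pascal n (λ i → g (suc n ∸ i) * U i K) ⟩
    sumTo n (λ i → + (n C i) * (g (suc n ∸ i) * U i K + g (n ∸ i) * U (suc i) K))
      ≡⟨ sumTo-cong n pascalTerm ⟩
    sumTo n (λ i → + (n C i) * (g (n ∸ i) * U i (K - 1ℤ)) + κ * (+ (n C i) * (g (n ∸ i) * U i K)))
      ≡⟨ sumTo-+ n _ _ ⟩
    binomialTransform a U n (K - 1ℤ) + sumTo n (λ i → κ * (+ (n C i) * (g (n ∸ i) * U i K)))
      ≡⟨ cong (λ s → binomialTransform a U n (K - 1ℤ) + s) (sumTo-*ˡ n κ _) ⟩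
    binomialTransform a U n (K - 1ℤ) + κ * binomialTransform a U n K ∎
    where
    g : ℕ → ℤ
    g t = gfall a t (- α)
    κ : ℤ
    κ = K * β + (+ n * α + (a + ρ))
    rearrange : ∀ c g a t i α β ρ K u u′ →
      c * (g * (a - t * - α) * u + g * (u′ + (K * β + (i * α + ρ)) * u))
        ≡ c * (g * u′) + (K * β + ((t + i) * α + (a + ρ))) * (c * (g * u))
    rearrange = solve-∀
    pascalTerm : ∀ i → i ℕ.≤ n →
      + (n C i) * (g (suc n ∸ i) * U i K + g (n ∸ i) * U (suc i) K)
        ≡ + (n C i) * (g (n ∸ i) * U i (K - 1ℤ)) + κ * (+ (n C i) * (g (n ∸ i) * U i K))
    pascalTerm i i≤n = begin
      + (n C i) * (g (suc n ∸ i) * U i K + g (n ∸ i) * U (suc i) K)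
        ≡⟨ cong₂ (λ t u → + (n C i) * (g t * U i K + g (n ∸ i) * u)) (ℕP.+-∸-assoc 1 i≤n) (rec i K) ⟩
      + (n C i) * (g (n ∸ i) * (a - + (n ∸ i) * - α) * U i K
                   + g (n ∸ i) * (U i (K - 1ℤ) + (K * β + (+ i * α + ρ)) * U i K))
        ≡⟨ rearrange (+ (n C i)) (g (n ∸ i)) a (+ (n ∸ i)) (+ i) α β ρ K (U i K) (U i (K - 1ℤ)) ⟩
      + (n C i) * (g (n ∸ i) * U i (K - 1ℤ))
        + (K * β + ((+ (n ∸ i) + + i) * α + (a + ρ))) * (+ (n C i) * (g (n ∸ i) * U i K))
        ≡⟨ cong (λ l → + (n C i) * (g (n ∸ i) * U i (K - 1ℤ))
                         + (K * β + (l * α + (a + ρ))) * (+ (n C i) * (g (n ∸ i) * U i K)))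
                (trans (sym (ℤP.pos-+ (n ∸ i) i)) (cong +_ (ℕP.m∸n+n≡m i≤n))) ⟩
      + (n C i) * (g (n ∸ i) * U i (K - 1ℤ)) + κ * (+ (n C i) * (g (n ∸ i) * U i K)) ∎

-- Generalized Stirling numbers

zeroRecurrence : ∀ {a b c : ℤ} κ → a ≡ 0ℤ → b ≡ 0ℤ → c ≡ 0ℤ → a ≡ b + κ * c
zeroRecurrence κ refl refl refl = sym (trans (ℤP.+-identityˡ _) (ℤP.*-zeroʳ κ))

module _ {α β : ℤ} {r : ℕ} {S : ℕ → ℤ → ℤ} (isStirling : IsGenStirling α β r S) where
  open IsGenStirling isStirling
  open Recurrence α β

  expansionAt : ∀ n y → gfall (y + + r) n (- α) ≡ sumTo n (λ k → S n (+ k) * gfall y k β)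
  expansionAt n y = trans (expansion n (y + + r))
                          (cong (λ w → sumTo n (λ k → S n (+ k) * gfall w k β)) (cancel y (+ r)))
    where
    cancel : ∀ a b → a + b - b ≡ a
    cancel = solve-∀

  S-recurrence : StirlingRecurrence (+ r) S
  S-recurrence n -[1+ t ] =
    zeroRecurrence (-[1+ t ] * β + (+ n * α + + r))
      (vanish-neg (suc n) _ -<+) (vanish-neg n _ -<+) (vanish-neg n _ -<+)
  S-recurrence n (+ k) with k ℕ.≤? suc n
  ... | yes k≤1+n = gfall-coeffs-unique β (suc n) (λ k → S (suc n) (+ k))
                      (λ k → S n (+ k - 1ℤ) + (+ k * β + (+ n * α + + r)) * S n (+ k))
                      sameExpansion k k≤1+n
    where
    sameExpansion : ∀ y → sumTo (suc n) (λ k → S (suc n) (+ k) * gfall y k β)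
      ≡ sumTo (suc n) (λ k → (S n (+ k - 1ℤ) + (+ k * β + (+ n * α + + r)) * S n (+ k)) * gfall y k β)
    sameExpansion y = begin
      sumTo (suc n) (λ k → S (suc n) (+ k) * gfall y k β)
        ≡⟨ expansionAt (suc n) y ⟨
      gfall (y + + r) n (- α) * (y + + r - + n * - α)
        ≡⟨ cong₂ _*_ (expansionAt n y) (regroup y (+ r) (+ n) α) ⟩
      sumTo n (λ k → S n (+ k) * gfall y k β) * (y + (+ n * α + + r))
        ≡⟨ sumTo-gfall-* n β (S n) y (+ n * α + + r)
             (vanish-neg n -1ℤ -<+) (vanish-big n _ (+<+ (ℕP.n<1+n n))) ⟩
      sumTo (suc n) (λ k → (S n (+ k - 1ℤ) + (+ k * β + (+ n * α + + r)) * S n (+ k))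
                             * gfall y k β) ∎
      where
      regroup : ∀ y r n α → y + r - n * - α ≡ y + (n * α + r)
      regroup = solve-∀
  ... | no k≰1+n = aboveRange k (ℕP.≰⇒> k≰1+n)
    where
    aboveRange : ∀ k → suc n ℕ.< k →
      S (suc n) (+ k) ≡ S n (+ k - 1ℤ) + (+ k * β + (+ n * α + + r)) * S n (+ k)
    aboveRange (suc k) (s≤s n<k) = zeroRecurrence (+ suc k * β + (+ n * α + + r))
      (vanish-big (suc n) _ (+<+ (s≤s n<k))) (vanish-big n _ (+<+ n<k))
      (vanish-big n _ (+<+ (ℕP.m<n⇒m<1+n n<k)))

  S-row0-diagonal : S 0 0ℤ ≡ 1ℤ
  S-row0-diagonal = trans (sym (ℤP.*-identityʳ _)) (sym (expansion 0 0ℤ))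

  S-row0-offDiagonal : ∀ K → K ≢ 0ℤ → S 0 K ≡ 0ℤ
  S-row0-offDiagonal (+ zero)  K≢0 = ⊥-elim (K≢0 refl)
  S-row0-offDiagonal (+ suc k) _   = vanish-big 0 _ (+<+ (s≤s z≤n))
  S-row0-offDiagonal -[1+ k ]  _   = vanish-neg 0 _ -<+

  offDiagonalTerm : ∀ m K j → K ≢ + j → S m (+ j) * S 0 (K - + j) ≡ 0ℤ
  offDiagonalTerm m K j K≢j =
    trans (cong (S m (+ j) *_) (S-row0-offDiagonal _ (K≢j ∘ ℤP.i-j≡0⇒i≡j K (+ j))))
          (ℤP.*-zeroʳ (S m (+ j)))

  convolution-row0 : ∀ m K → sumTo m (λ j → S m (+ j) * S 0 (K - + j)) ≡ S m K
  convolution-row0 m (+ k) with k ℕ.≤? m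
  ... | yes k≤m = begin
    sumTo m (λ j → S m (+ j) * S 0 (+ k - + j))
      ≡⟨ sumTo-single m k _ k≤m (λ j _ j≢k →
           offDiagonalTerm m (+ k) j (j≢k ∘ sym ∘ ℤP.+-injective)) ⟩
    S m (+ k) * S 0 (+ k - + k) ≡⟨ cong (λ z → S m (+ k) * S 0 z) (ℤP.+-inverseʳ (+ k)) ⟩
    S m (+ k) * S 0 0ℤ          ≡⟨ cong (S m (+ k) *_) S-row0-diagonal ⟩
    S m (+ k) * 1ℤ              ≡⟨ ℤP.*-identityʳ _ ⟩
    S m (+ k)                   ∎
  ... | no k≰m = trans
    (sumTo-zero m (λ j j≤m → offDiagonalTerm m (+ k) j
                               (λ k≡j → k≰m (subst (ℕ._≤ m) (sym (ℤP.+-injective k≡j)) j≤m))))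
    (sym (vanish-big m _ (+<+ (ℕP.≰⇒> k≰m))))
  convolution-row0 m -[1+ k ] =
    trans (sumTo-zero m (λ j _ → offDiagonalTerm m -[1+ k ] j λ ())) (sym (vanish-neg m _ -<+))

  additionSum : ℕ → ℕ → ℤ → ℤ
  additionSum m n K = sumTo m (λ j → S m (+ j) * binomialTransform (+ j * β + + m * α) S n (K - + j))

  additionSum-recurrence : ∀ m → StirlingRecurrence (+ m * α + + r) (additionSum m)
  additionSum-recurrence m =
    StirlingRecurrence-sum m (λ j → S m (+ j)) (λ j n K → binomialTransform (a j) S n (K - + j))
      (λ j → StirlingRecurrence-shiftColumn {U = binomialTransform (a j) S} j
               (subst (λ ρ → StirlingRecurrence ρ (binomialTransform (a j) S))
                      (ℤP.+-assoc (+ j * β) (+ m * α) (+ r))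
                      (StirlingRecurrence-binomialTransform {U = S} (a j) S-recurrence)))
    where
    a : ℕ → ℤ
    a j = + j * β + + m * α

  S-addition : ∀ m n K → S (m ℕ.+ n) K ≡ additionSum m n K
  S-addition m = StirlingRecurrence-unique (StirlingRecurrence-shiftRow {U = S} m S-recurrence)
                   (additionSum-recurrence m) row0
    where
    row0 : ∀ K → S (m ℕ.+ 0) K ≡ additionSum m 0 K
    row0 K = begin
      S (m ℕ.+ 0) K ≡⟨ cong (λ l → S l K) (ℕP.+-identityʳ m) ⟩
      S m K         ≡⟨ convolution-row0 m K ⟨
      sumTo m (λ j → S m (+ j) * S 0 (K - + j))
        ≡⟨ sumTo-cong m (λ j _ →
             cong (S m (+ j) *_) (binomialTransform-zero (+ j * β + + m * α) S (K - + j))) ⟨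
      additionSum m 0 K ∎

  gfall-weight : ∀ m j t →
    gfall (+ j * β + + m * α) t (- α) ≡ prodBelow t (λ ℓ → (+ (m ℕ.+ ℓ)) * α + (+ j) * β)
  gfall-weight m j t = prodBelow-cong t (λ ℓ →
    trans (regroup (+ j) (+ m) (+ ℓ) α β) (cong (λ l → l * α + + j * β) (sym (ℤP.pos-+ m ℓ))))
    where
    regroup : ∀ j m ℓ α β → j * β + m * α - ℓ * - α ≡ (m + ℓ) * α + j * β
    regroup = solve-∀

  stirling-addition : ∀ (m n k : ℕ) →
    S (m ℕ.+ n) (+ k)
      ≡ sumTo n (λ i → sumTo m (λ j →
          + (n C i) * S m (+ j) * S i (+ k - + j)
            * prodBelow (n ∸ i) (λ ℓ → (+ (m ℕ.+ ℓ)) * α + (+ j) * β)))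
  stirling-addition m n k = begin
    S (m ℕ.+ n) (+ k)
      ≡⟨ S-addition m n (+ k) ⟩
    sumTo m (λ j → S m (+ j) * sumTo n (λ i → + (n C i) * (g j (n ∸ i) * S i (+ k - + j))))
      ≡⟨ sumTo-cong m (λ j _ → sumTo-*ˡ n (S m (+ j)) _) ⟨
    sumTo m (λ j → sumTo n (λ i → S m (+ j) * (+ (n C i) * (g j (n ∸ i) * S i (+ k - + j)))))
      ≡⟨ sumTo-swap n m _ ⟨
    sumTo n (λ i → sumTo m (λ j → S m (+ j) * (+ (n C i) * (g j (n ∸ i) * S i (+ k - + j)))))
      ≡⟨ sumTo-cong n (λ i _ → sumTo-cong m (λ j _ →
           trans (cong (λ p → S m (+ j) * (+ (n C i) * (p * S i (+ k - + j)))) (gfall-weight m j (n ∸ i)))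
                 (rearrange (S m (+ j)) (+ (n C i)) _ (S i (+ k - + j))))) ⟩
    sumTo n (λ i → sumTo m (λ j → + (n C i) * S m (+ j) * S i (+ k - + j)
                                    * prodBelow (n ∸ i) (λ ℓ → (+ (m ℕ.+ ℓ)) * α + (+ j) * β))) ∎
    where
    g : ℕ → ℕ → ℤ
    g j t = gfall (+ j * β + + m * α) t (- α)
    rearrange : ∀ s c p t → s * (c * (p * t)) ≡ c * s * t * p
    rearrange = solve-∀

  bell-addition : ∀ (m n : ℕ) (x : ℤ) →
    bell S (m ℕ.+ n) x
      ≡ sumTo n (λ i → sumTo m (λ j →
          + (n C i) * x ^ j * S m (+ j) * bell S i x
            * prodBelow (n ∸ i) (λ ℓ → (+ (m ℕ.+ ℓ)) * α + (+ j) * β)))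
  bell-addition m n x = begin
    sumTo (m ℕ.+ n) (λ K → S (m ℕ.+ n) (+ K) * x ^ K)
      ≡⟨ sumTo-cong (m ℕ.+ n) (λ K _ → trans (cong (_* x ^ K) (stirling-addition m n K))
           (trans (sym (sumTo-*ʳ n (x ^ K) _)) (sumTo-cong n (λ i _ → sym (sumTo-*ʳ m (x ^ K) _))))) ⟩
    sumTo (m ℕ.+ n) (λ K → sumTo n (λ i → sumTo m (λ j → t i j K)))
      ≡⟨ sumTo-swap (m ℕ.+ n) n _ ⟩
    sumTo n (λ i → sumTo (m ℕ.+ n) (λ K → sumTo m (λ j → t i j K)))
      ≡⟨ sumTo-cong n (λ i _ → sumTo-swap (m ℕ.+ n) m _) ⟩
    sumTo n (λ i → sumTo m (λ j → sumTo (m ℕ.+ n) (λ K → t i j K)))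
      ≡⟨ sumTo-cong n (λ i i≤n → sumTo-cong m (λ j j≤m → sumOverK i j i≤n j≤m)) ⟩
    sumTo n (λ i → sumTo m (λ j → + (n C i) * x ^ j * S m (+ j) * bell S i x * P j (n ∸ i))) ∎
    where
    P : ℕ → ℕ → ℤ
    P j t = prodBelow t (λ ℓ → (+ (m ℕ.+ ℓ)) * α + (+ j) * β)
    t : ℕ → ℕ → ℕ → ℤ
    t i j K = + (n C i) * S m (+ j) * S i (+ K - + j) * P j (n ∸ i) * x ^ K
    separate : ∀ c s u p y → c * s * u * p * y ≡ (c * s * p) * (u * y)
    separate = solve-∀
    rearrange : ∀ c s p a b → (c * s * p) * (a * b) ≡ c * a * s * b * p
    rearrange = solve-∀
    sumOverK : ∀ i j → i ℕ.≤ n → j ℕ.≤ m →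
      sumTo (m ℕ.+ n) (t i j) ≡ + (n C i) * x ^ j * S m (+ j) * bell S i x * P j (n ∸ i)
    sumOverK i j i≤n j≤m = begin
      sumTo (m ℕ.+ n) (t i j)
        ≡⟨ sumTo-cong (m ℕ.+ n) (λ K _ →
             separate (+ (n C i)) (S m (+ j)) (S i (+ K - + j)) (P j (n ∸ i)) (x ^ K)) ⟩
      sumTo (m ℕ.+ n) (λ K → (+ (n C i) * S m (+ j) * P j (n ∸ i)) * (S i (+ K - + j) * x ^ K))
        ≡⟨ sumTo-*ˡ (m ℕ.+ n) (+ (n C i) * S m (+ j) * P j (n ∸ i)) (λ K → S i (+ K - + j) * x ^ K) ⟩
      (+ (n C i) * S m (+ j) * P j (n ∸ i)) * sumTo (m ℕ.+ n) (λ K → S i (+ K - + j) * x ^ K)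
        ≡⟨ cong ((+ (n C i) * S m (+ j) * P j (n ∸ i)) *_)
                (sumTo-shiftedCoeffs (S i) i j (m ℕ.+ n) x (vanish-neg i) (vanish-big i)
                                     (ℕP.+-mono-≤ j≤m i≤n)) ⟩
      (+ (n C i) * S m (+ j) * P j (n ∸ i)) * (x ^ j * bell S i x)
        ≡⟨ rearrange (+ (n C i)) (S m (+ j)) (P j (n ∸ i)) (x ^ j) (bell S i x) ⟩
      + (n C i) * x ^ j * S m (+ j) * bell S i x * P j (n ∸ i) ∎

theorem3p8 : (α β : ℤ) (r : ℕ) (S : ℕ → ℤ → ℤ) → IsGenStirling α β r S →
    (∀ (m n k : ℕ) →
      S (m Data.Nat.+ n) (+ k)
        ≡ sumTo n (λ i → sumTo m (λ j →
            + (n C i) * S m (+ j) * S i (+ k - + j)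
              * prodBelow (n ∸ i) (λ ℓ → (+ (m Data.Nat.+ ℓ)) * α + (+ j) * β))))
    ×
    (∀ (m n : ℕ) (x : ℤ) →
      bell S (m Data.Nat.+ n) x
        ≡ sumTo n (λ i → sumTo m (λ j →
            + (n C i) * x ^ j * S m (+ j) * bell S i x
              * prodBelow (n ∸ i) (λ ℓ → (+ (m Data.Nat.+ ℓ)) * α + (+ j) * β))))
theorem3p8 α β r S isStirling = stirling-addition isStirling , bell-addition isStirling
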